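{- Let $G$ be a graph of order $n$ such that there exists a unique $\gamma(G)$-set and $\gamma(G)=\beta(G)$. Then for any integer $t\ge 2$, $$\gamma(S(G,t))=n^{t-2}\bigl(n\gamma(G)-\xi(G)\bigr).$$
   Context: A set $D\subseteq V$ is dominating in $G=(V,E)$ if every vertex of $V\setminus D$ has a neighbour in $D$; the domination number $\gamma(G)$ is the minimum cardinality of a dominating set, and a dominating set of cardinality $\gamma(G)$ is a $\gamma(G)$-set. $\beta(G)$ is the vertex cover number (minimum cardinality of a set of vertices meeting every edge). Let $\mathcal D(G)$ be the set of all $\gamma(G)$-sets. Define $\xi(G)=\max_{D\in\mathcal D(G)}\{|D'|:\ D'\subseteq D \text{ and the subgraph induced by } D' \text{ has no isolated vertices}\}$ (the empty set is allowed). For a positive integer $t$, $V^t$ denotes the set of words $u=u_1\cdots u_t$ of length $t$ over $V$. The generalized Sierpiński graph $S(G,t)$ has vertex set $V^t$, and $\{u,v\}$ is an edge if and only if there is $i\in\{1,\dots,t\}$ such that: (i) $u_j=v_j$ for all $j<i$; (ii) $u_i\ne v_i$ and $\{u_i,v_i\}\in E$; (iii) $u_j=v_i$ and $v_j=u_i$ for all $j>i$. -}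

module Defs where

open import Data.Nat using (ℕ; _≤_)
open import Data.Fin using (Fin; _<_)
open import Data.Vec using (Vec; lookup)
open import Data.List using (List; length)
open import Data.List.Membership.Propositional using (_∈_)
open import Data.List.Relation.Unary.Unique.Propositional using (Unique)
open import Data.Product using (Σ; _×_; ∃)
open import Data.Sum using (_⊎_)
open import Relation.Binary.PropositionalEquality using (_≡_; _≢_)

-- Graphs are given by a vertex type V and an adjacency relation Adj on V.
-- Finite vertex sets are represented as duplicate-free lists; cardinality = length.

module _ {V : Set} (Adj : V → V → Set) where

  _⊆ₗ_ : List V → List V → Set
  A ⊆ₗ B = ∀ v → v ∈ A → v ∈ B

  Dominating : List V → Set
  Dominating D = ∀ v → v ∈ D ⊎ ∃ λ u → u ∈ D × Adj v u

  IsGammaSet : List V → Set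
  IsGammaSet D = Unique D × Dominating D
    × (∀ D' → Unique D' → Dominating D' → length D ≤ length D')

  IsDominationNumber : ℕ → Set
  IsDominationNumber k = Σ (List V) λ D → IsGammaSet D × length D ≡ k

  -- there is exactly one γ(G)-set (as a set of vertices)
  UniqueGammaSet : Set
  UniqueGammaSet = Σ (List V) λ D → IsGammaSet D
    × (∀ D' → IsGammaSet D' → (D' ⊆ₗ D) × (D ⊆ₗ D'))

  VertexCover : List V → Set
  VertexCover C = ∀ u v → Adj u v → u ∈ C ⊎ v ∈ C

  IsVertexCoverNumber : ℕ → Set
  IsVertexCoverNumber k =
    (Σ (List V) λ C → Unique C × VertexCover C × length C ≡ k)
    × (∀ C → Unique C → VertexCover C → k ≤ length C)

  NoIsolated : List V → Set
  NoIsolated D' = ∀ v → v ∈ D' → ∃ λ u → u ∈ D' × Adj v u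

  XiCandidate : List V → Set
  XiCandidate D' = Σ (List V) λ D → IsGammaSet D × Unique D' × (D' ⊆ₗ D) × NoIsolated D'

  IsXi : ℕ → Set
  IsXi k = (Σ (List V) λ D' → XiCandidate D' × length D' ≡ k)
    × (∀ D' → XiCandidate D' → length D' ≤ k)

-- adjacency of the generalized Sierpiński graph S(G,t) on words Vec (Fin n) t
SAdj : {n : ℕ} → (Fin n → Fin n → Set) → (t : ℕ) → Vec (Fin n) t → Vec (Fin n) t → Set
SAdj {n} Adj t u v = Σ (Fin t) λ i →
    (∀ j → j < i → lookup u j ≡ lookup v j)
  × lookup u i ≢ lookup v i
  × Adj (lookup u i) (lookup v i)
  × (∀ j → i < j → (lookup u j ≡ lookup v i) × (lookup v j ≡ lookup u i))

module Submission where

-- Write t = k+2 and view a word of length k+2 as a letter z appended to a "copy" w of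
-- length k+1; the extreme vertex of copy w is w·last w.
--
-- Upper bound (module UpperBound): given a γ(G)-set D₁ and X ⊆ D₁ without isolated vertices
-- (realising ξ(G)), keep in each copy w the letters of D₁, except the extreme vertex when
-- last w ∈ X.  This dominates S(G,k+2) and has n^(k+1)·γ(G) − n^k·ξ(G) vertices.
--
-- Lower bound (module LowerBound): for a dominating set S, the trace of S on a copy w,
-- together with last w, dominates G (lemma neighbour-cases classifies the neighbours of
-- w·z).  Comparing with γ(G), and using that D is the only dominating set of size γ(G),
-- gives a per-copy inequality whose error terms are charged either to D°, the vertices of D
-- with a neighbour in D, or to the mate copy swapTail w; swapTail is an involution, so
-- summing over all copies yields n^(k+1)·γ(G) ≤ |S| + n^k·|D°| ≤ |S| + n^k·ξ(G).

open import Data.Bool.Base using (if_then_else_)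
open import Data.Fin using (Fin; zero; suc)
open import Data.Fin.Properties using () renaming (_≟_ to _≟ᶠ_)
open import Data.List using (List; []; _∷_; [_]; _++_; length; map; filter; allFin; cartesianProductWith)
open import Data.List.Properties using (map-++; map-∘; map-cong; length-tabulate)
open import Data.List.Membership.Propositional using (_∈_; _∉_; lose; find)
open import Data.List.Membership.Propositional.Properties
  using (∈-filter⁺; ∈-filter⁻; ∈-allFin; ∈-map⁺; ∈-cartesianProductWith⁺)
open import Data.List.Membership.Propositional.Properties.WithK using (unique∧set⇒bag)
import Data.List.Membership.DecPropositional as DecMembership
open import Data.List.Relation.Binary.BagAndSetEquality using (∼bag⇒↭)
open import Data.List.Relation.Binary.Permutation.Propositional.Properties
  using (↭-length) renaming (map⁺ to ↭-map⁺)
import Data.List.Relation.Unary.All as ListAll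
open import Data.List.Relation.Unary.All.Properties using (¬Any⇒All¬)
open import Data.List.Relation.Unary.Any using (here; there; any?)
open import Data.List.Relation.Unary.Unique.Propositional using (Unique; []; _∷_)
open import Data.List.Relation.Unary.Unique.Propositional.Properties
  using (filter⁺; allFin⁺; cartesianProductWith⁺) renaming (map⁺ to unique-map⁺)
open import Data.Nat using (ℕ; zero; suc; _+_; _*_; _∸_; _^_; _≤_; _<_; _≤?_; z≤n; s≤s)
open import Data.Nat.ListAction using (sum)
open import Data.Nat.ListAction.Properties using (sum-++; sum-↭)
open import Data.Nat.Properties
open import Algebra.Properties.CommutativeSemigroup +-commutativeSemigroup
  using () renaming (interchange to +-interchange)
open import Data.Product using (∃; _×_; _,_; proj₁; proj₂)
open import Data.Sum using (_⊎_; inj₁; inj₂)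
open import Data.Vec using (Vec; []; _∷_; _∷ʳ_; replicate; init; last; initLast)
open import Data.Vec.Properties using (∷ʳ-injective; ≡-dec; init-∷ʳ; last-∷ʳ)
open import Data.Vec.Relation.Unary.All as VecAll using (All; []; _∷_)
open import Data.Vec.Relation.Unary.All.Properties using (lookup⁺; lookup⁻)
open import Function using (_∘_; _∘₂_)
open import Function.Bundles using (mk⇔)
open import Relation.Binary.Definitions using (DecidableEquality)
open import Relation.Binary.PropositionalEquality
  using (_≡_; _≢_; refl; sym; trans; cong; cong₂; subst; subst₂; module ≡-Reasoning)
open import Relation.Nullary using (¬_; Dec; yes; no; does; contradiction; ¬¬-map)
open import Relation.Nullary.Decidable using (_×-dec_; ¬?; decidable-stable; ¬¬-excluded-middle)
open import Relation.Unary using (Pred; Decidable)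
open import Defs

ind : ∀ {p} {P : Set p} → Dec P → ℕ
ind d = if does d then 1 else 0

ind-⇔ : ∀ {p q} {P : Set p} {Q : Set q} (a : Dec P) (b : Dec Q) → (P → Q) → (Q → P) → ind a ≡ ind b
ind-⇔ (yes _) (yes _) _ _ = refl
ind-⇔ (yes p) (no ¬q) f _ = contradiction (f p) ¬q
ind-⇔ (no ¬p) (yes q) _ g = contradiction (g q) ¬p
ind-⇔ (no _) (no _) _ _ = refl

ind-yes : ∀ {p} {P : Set p} (d : Dec P) → P → ind d ≡ 1
ind-yes (yes _) _ = refl
ind-yes (no ¬p) p = contradiction p ¬p

ind-no : ∀ {p} {P : Set p} (d : Dec P) → ¬ P → ind d ≡ 0
ind-no (yes p) ¬p = contradiction p ¬p
ind-no (no _) _ = refl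

ind-split : ∀ {p q} {P : Set p} {Q : Set q} (p? : Dec P) (q? : Dec Q) → (Q → P)
  → ind (p? ×-dec ¬? q?) + ind q? ≡ ind p?
ind-split (yes _) (yes _) _ = refl
ind-split (yes _) (no _) _ = refl
ind-split (no _) (no _) _ = refl
ind-split (no ¬p) (yes q) Q⇒P = contradiction (Q⇒P q) ¬p

module _ {a} {A : Set a} where

  sum-map-+ : ∀ (f g : A → ℕ) xs → sum (map (λ x → f x + g x) xs) ≡ sum (map f xs) + sum (map g xs)
  sum-map-+ f g [] = refl
  sum-map-+ f g (x ∷ xs) = trans (cong (f x + g x +_) (sum-map-+ f g xs))
    (+-interchange (f x) (g x) (sum (map f xs)) (sum (map g xs)))

  sum-map-mono : ∀ {f g : A → ℕ} → (∀ x → f x ≤ g x) → ∀ xs → sum (map f xs) ≤ sum (map g xs)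
  sum-map-mono f≤g [] = z≤n
  sum-map-mono f≤g (x ∷ xs) = +-mono-≤ (f≤g x) (sum-map-mono f≤g xs)

  sum-map-const : ∀ c xs → sum (map (λ (_ : A) → c) xs) ≡ length xs * c
  sum-map-const c [] = refl
  sum-map-const c (x ∷ xs) = cong (c +_) (sum-map-const c xs)

  sum-map-ind : ∀ {p} {P : Pred A p} (P? : Decidable P) xs
    → sum (map (λ x → ind (P? x)) xs) ≡ length (filter P? xs)
  sum-map-ind P? [] = refl
  sum-map-ind P? (x ∷ xs) with P? x
  ... | yes _ = cong suc (sum-map-ind P? xs)
  ... | no _ = sum-map-ind P? xs

  unique-same-length : ∀ {xs ys : List A} → Unique xs → Unique ys
    → (∀ {x} → x ∈ xs → x ∈ ys) → (∀ {x} → x ∈ ys → x ∈ xs) → length xs ≡ length ys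
  unique-same-length uxs uys to from = ↭-length (∼bag⇒↭ (unique∧set⇒bag uxs uys (mk⇔ to from)))

sum-map-cartesianProductWith : ∀ {a b c} {A : Set a} {B : Set b} {C : Set c}
  (f : A → B → C) (h : C → ℕ) xs ys
  → sum (map h (cartesianProductWith f xs ys)) ≡ sum (map (λ x → sum (map (λ y → h (f x y)) ys)) xs)
sum-map-cartesianProductWith f h [] ys = refl
sum-map-cartesianProductWith f h (x ∷ xs) ys = begin
  sum (map h (map (f x) ys ++ cartesianProductWith f xs ys))
    ≡⟨ cong sum (map-++ h (map (f x) ys) _) ⟩
  sum (map h (map (f x) ys) ++ map h (cartesianProductWith f xs ys))
    ≡⟨ sum-++ (map h (map (f x) ys)) _ ⟩
  sum (map h (map (f x) ys)) + sum (map h (cartesianProductWith f xs ys))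
    ≡⟨ cong₂ _+_ (cong sum (sym (map-∘ ys))) (sum-map-cartesianProductWith f h xs ys) ⟩
  sum (map (λ y → h (f x y)) ys) + sum (map (λ x → sum (map (λ y → h (f x y)) ys)) xs) ∎
  where open ≡-Reasoning

module Enumeration {X : Set} (_≟_ : DecidableEquality X) (elems : List X)
  (elems-unique : Unique elems) (elems-complete : ∀ x → x ∈ elems) where

  open DecMembership _≟_ using (_∈?_)

  ∑ : (X → ℕ) → ℕ
  ∑ h = sum (map h elems)

  ∑-cong : ∀ {f g : X → ℕ} → (∀ x → f x ≡ g x) → ∑ f ≡ ∑ g
  ∑-cong f≗g = cong sum (map-cong f≗g elems)

  ∑-mono : ∀ {f g : X → ℕ} → (∀ x → f x ≤ g x) → ∑ f ≤ ∑ g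
  ∑-mono f≤g = sum-map-mono f≤g elems

  ∑-+ : ∀ (f g : X → ℕ) → ∑ (λ x → f x + g x) ≡ ∑ f + ∑ g
  ∑-+ f g = sum-map-+ f g elems

  ∑-count : ∀ {L} → Unique L → ∑ (λ x → ind (x ∈? L)) ≡ length L
  ∑-count {L} uL = trans (sum-map-ind (_∈? L) elems)
    (unique-same-length (filter⁺ (_∈? L) elems-unique) uL
      (λ m → proj₂ (∈-filter⁻ (_∈? L) {xs = elems} m))
      (λ {x} m → ∈-filter⁺ (_∈? L) (elems-complete x) m))

  ∑-point : ∀ {p} {P : Pred X p} (P? : Decidable P) y → (∀ x → P x → x ≡ y)
    → ∑ (λ x → ind (P? x)) ≡ ind (P? y)
  ∑-point {P = P} P? y only-y with P? y
  ... | yes Py = trans (∑-cong (λ x → ind-⇔ (P? x) (x ∈? [ y ]) (λ Px → here (only-y x Px))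
                                              (λ { (here refl) → Py })))
                       (∑-count (ListAll.[] ∷ []))
  ... | no ¬Py = trans (∑-cong (λ x → ind-⇔ (P? x) (x ∈? [])
                                              (λ Px → contradiction (subst P (only-y x Px) Px) ¬Py) λ ()))
                       (∑-count [])

  ∑-involution : ∀ (f : X → X) → (∀ x → f (f x) ≡ x) → ∀ h → ∑ (λ x → h (f x)) ≡ ∑ h
  ∑-involution f f-invol h = begin
    sum (map (λ x → h (f x)) elems) ≡⟨ cong sum (map-∘ elems) ⟩
    sum (map h (map f elems))       ≡⟨ sum-↭ (↭-map⁺ h f-elems↭elems) ⟩
    sum (map h elems)               ∎
    where
    open ≡-Reasoning
    f-injective : ∀ {x y} → f x ≡ f y → x ≡ y
    f-injective {x} {y} fx≡fy = trans (sym (f-invol x)) (trans (cong f fx≡fy) (f-invol y))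
    f-elems↭elems = ∼bag⇒↭ (unique∧set⇒bag (unique-map⁺ f-injective elems-unique) elems-unique
      (λ {x} → mk⇔ (λ _ → elems-complete x)
                   (λ _ → subst (_∈ map f elems) (f-invol x) (∈-map⁺ f (elems-complete (f x))))))

words : ∀ n m → List (Vec (Fin n) m)
words n zero = [] ∷ []
words n (suc m) = cartesianProductWith _∷ʳ_ (words n m) (allFin n)

words-unique : ∀ n m → Unique (words n m)
words-unique n zero = ListAll.[] ∷ []
words-unique n (suc m) =
  cartesianProductWith⁺ _∷ʳ_ (λ eq → ∷ʳ-injective _ _ eq) (words-unique n m) (allFin⁺ n)

init-∷ʳ-last : ∀ {A : Set} {m} (u : Vec A (suc m)) → init u ∷ʳ last u ≡ u
init-∷ʳ-last u = sym (proj₂ (proj₂ (initLast u)))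

words-complete : ∀ n m (u : Vec (Fin n) m) → u ∈ words n m
words-complete n zero [] = here refl
words-complete n (suc m) u = subst (_∈ words n (suc m)) (init-∷ʳ-last u)
  (∈-cartesianProductWith⁺ _∷ʳ_ (words-complete n m (init u)) (∈-allFin (last u)))

module WordSums (n : ℕ) where

  module Letters = Enumeration _≟ᶠ_ (allFin n) (allFin⁺ n) ∈-allFin
  module Words (m : ℕ) = Enumeration (≡-dec _≟ᶠ_) (words n m) (words-unique n m) (words-complete n m)
  open Letters public using () renaming (∑ to ∑ᶠ)
  open Words public using () renaming (∑ to ∑ʷ)

  ∑ʷ-∷ʳ : ∀ m h → ∑ʷ (suc m) h ≡ ∑ʷ m (λ w → ∑ᶠ (λ z → h (w ∷ʳ z)))
  ∑ʷ-∷ʳ m h = sum-map-cartesianProductWith _∷ʳ_ h (words n m) (allFin n)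

  ∑ʷ-const : ∀ m c → ∑ʷ m (λ _ → c) ≡ n ^ m * c
  ∑ʷ-const zero c = refl
  ∑ʷ-const (suc m) c = begin
    ∑ʷ (suc m) (λ _ → c)              ≡⟨ ∑ʷ-∷ʳ m (λ _ → c) ⟩
    ∑ʷ m (λ _ → ∑ᶠ (λ _ → c))         ≡⟨ Words.∑-cong m (λ _ → sum-map-const c (allFin n)) ⟩
    ∑ʷ m (λ _ → length (allFin n) * c) ≡⟨ ∑ʷ-const m _ ⟩
    n ^ m * (length (allFin n) * c)   ≡⟨ cong (λ l → n ^ m * (l * c)) (length-tabulate {n = n} (λ i → i)) ⟩
    n ^ m * (n * c)                   ≡⟨ *-assoc (n ^ m) n c ⟨
    n ^ m * n * c                     ≡⟨ cong (_* c) (*-comm (n ^ m) n) ⟩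
    n * n ^ m * c                     ∎
    where open ≡-Reasoning

  open DecMembership (_≟ᶠ_ {n}) public using () renaming (_∈?_ to _∈ᶠ?_)

  _∈ʷ?_ : ∀ {m} (u : Vec (Fin n) m) L → Dec (u ∈ L)
  _∈ʷ?_ = DecMembership._∈?_ (≡-dec _≟ᶠ_)

  ∑ʷ-last-count : ∀ m {L : List (Fin n)} → Unique L
    → ∑ʷ (suc m) (λ w → ind (last w ∈ᶠ? L)) ≡ n ^ m * length L
  ∑ʷ-last-count m {L} uL = begin
    ∑ʷ (suc m) (λ w → ind (last w ∈ᶠ? L))
      ≡⟨ ∑ʷ-∷ʳ m (λ w → ind (last w ∈ᶠ? L)) ⟩
    ∑ʷ m (λ p → ∑ᶠ (λ z → ind (last (p ∷ʳ z) ∈ᶠ? L)))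
      ≡⟨ Words.∑-cong m (λ p → Letters.∑-cong (λ z → cong (λ y → ind (y ∈ᶠ? L)) (last-∷ʳ z p))) ⟩
    ∑ʷ m (λ p → ∑ᶠ (λ z → ind (z ∈ᶠ? L)))
      ≡⟨ Words.∑-cong m (λ p → Letters.∑-count uL) ⟩
    ∑ʷ m (λ p → length L)
      ≡⟨ ∑ʷ-const m (length L) ⟩
    n ^ m * length L ∎
    where open ≡-Reasoning

-- Double-negation shift over a finite domain; it makes adjacency of G decidable
-- classically, which suffices when proving a decidable statement.
¬¬-∀-Fin : ∀ {m p} {P : Fin m → Set p} → (∀ i → ¬ ¬ P i) → ¬ ¬ (∀ i → P i)
¬¬-∀-Fin {zero} _ ¬all = ¬all (λ ())
¬¬-∀-Fin {suc m} {P = P} ¬¬P ¬all = ¬¬P zero λ P0 →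
  ¬¬-∀-Fin {m} {P = P ∘ suc} (¬¬P ∘ suc) λ Psuc → ¬all λ { zero → P0 ; (suc i) → Psuc i }

module _ {V : Set} {Adj : V → V → Set} where

  γ-sets-same-size : ∀ {D D'} → IsGammaSet Adj D → IsGammaSet Adj D' → length D ≡ length D'
  γ-sets-same-size (uD , domD , minD) (uD' , domD' , minD') = ≤-antisym (minD _ uD' domD') (minD' _ uD domD)

  dominating-⊆ : ∀ {L M : List V} → (∀ {x} → x ∈ L → x ∈ M) → Dominating Adj L → Dominating Adj M
  dominating-⊆ L⊆M domL z with domL z
  ... | inj₁ z∈L = inj₁ (L⊆M z∈L)
  ... | inj₂ (y , y∈L , adj) = inj₂ (y , L⊆M y∈L , adj)

  dominating-map : ∀ {Adj' : V → V → Set} → (∀ {u v} → Adj u v → Adj' u v)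
    → ∀ {S} → Dominating Adj S → Dominating Adj' S
  dominating-map Adj⇒Adj' domS u with domS u
  ... | inj₁ u∈S = inj₁ u∈S
  ... | inj₂ (v , v∈S , adj) = inj₂ (v , v∈S , Adj⇒Adj' adj)

module Sierpinski (n : ℕ) (Adj : Fin n → Fin n → Set)
  (Adj-sym : ∀ a b → Adj a b → Adj b a) (Adj-irrefl : ∀ a → ¬ Adj a a) where

  open WordSums n

  Word : ℕ → Set
  Word = Vec (Fin n)

  Adj⇒≢ : ∀ {a b} → Adj a b → a ≢ b
  Adj⇒≢ {a} adj refl = Adj-irrefl a adj

  data _~_ : ∀ {m} → Word m → Word m → Set where
    deeper : ∀ {m a} {u v : Word m} → u ~ v → (a ∷ u) ~ (a ∷ v)
    top    : ∀ {m a b} {u v : Word m} → Adj a b → All (_≡ b) u → All (_≡ a) v → (a ∷ u) ~ (b ∷ v)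

  ~⇒SAdj : ∀ {m} {u v : Word m} → u ~ v → SAdj Adj m u v
  ~⇒SAdj (top adj u≡b v≡a) =
    zero , (λ _ ()) , Adj⇒≢ adj , adj , λ { zero () ; (suc j) _ → lookup⁺ u≡b j , lookup⁺ v≡a j }
  ~⇒SAdj (deeper r) with ~⇒SAdj r
  ... | i , before , ≢ , adj , after =
    suc i , (λ { zero _ → refl ; (suc j) (s≤s j<i) → before j j<i }) , ≢ , adj ,
    λ { zero () ; (suc j) (s≤s i<j) → after j i<j }

  SAdj⇒~ : ∀ {m} (u v : Word m) → SAdj Adj m u v → u ~ v
  SAdj⇒~ (a ∷ u) (b ∷ v) (zero , _ , _ , adj , after) =
    top adj (lookup⁻ (λ j → proj₁ (after (suc j) (s≤s z≤n))))
            (lookup⁻ (λ j → proj₂ (after (suc j) (s≤s z≤n))))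
  SAdj⇒~ (a ∷ u) (b ∷ v) (suc i , before , ≢ , adj , after) with before zero (s≤s z≤n)
  ... | refl = deeper (SAdj⇒~ u v (i , (λ j j<i → before (suc j) (s≤s j<i)) , ≢ , adj ,
                                         λ j i<j → after (suc j) (s≤s i<j)))

  same-copy-edge : ∀ {m} (w : Word m) {z z'} → Adj z z' → (w ∷ʳ z) ~ (w ∷ʳ z')
  same-copy-edge [] adj = top adj [] []
  same-copy-edge (a ∷ w) adj = deeper (same-copy-edge w adj)

  adjacent-copy-edge : ∀ {m} (p : Word m) {x z} → Adj x z → (p ∷ʳ x ∷ʳ z) ~ (p ∷ʳ z ∷ʳ x)
  adjacent-copy-edge [] adj = top adj (refl ∷ []) (refl ∷ [])
  adjacent-copy-edge (a ∷ p) adj = deeper (adjacent-copy-edge p adj)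

  TailBlock : ∀ {m} → Fin n → Fin n → Word m → Set
  TailBlock a b w = All (_≡ b) w × a ≢ b

  tailBlock? : ∀ {m} a b (w : Word m) → Dec (TailBlock a b w)
  tailBlock? a b w = VecAll.all? (_≟ᶠ b) w ×-dec ¬? (a ≟ᶠ b)

  -- An edge of S(G,k+2) leaving an extreme vertex towards a copy whose last letter is not
  -- adjacent to it can only end at the extreme vertex of copy swapTail w (see NeighbourOf).
  swapTail : ∀ {m} → Word (suc m) → Word (suc m)
  swapTail (a ∷ []) = a ∷ []
  swapTail (a ∷ b ∷ w) with tailBlock? a b w
  ... | yes _ = b ∷ replicate _ a
  ... | no _ = a ∷ swapTail (b ∷ w)

  swapTail-block : ∀ {m} a b (w : Word m) → TailBlock a b w → swapTail (a ∷ b ∷ w) ≡ b ∷ replicate _ a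
  swapTail-block a b w block with tailBlock? a b w
  ... | yes _ = refl
  ... | no ¬block = contradiction block ¬block

  swapTail-∷ : ∀ {m} a b (w : Word m) → ¬ TailBlock a b w
    → swapTail (a ∷ b ∷ w) ≡ a ∷ swapTail (b ∷ w)
  swapTail-∷ a b w ¬block with tailBlock? a b w
  ... | yes block = contradiction block ¬block
  ... | no _ = refl

  swapTail-const : ∀ {m} b (w : Word m) → All (_≡ b) w → swapTail (b ∷ w) ≡ b ∷ w
  swapTail-const b [] [] = refl
  swapTail-const b (c ∷ w) (refl ∷ w≡b) =
    trans (swapTail-∷ b b w (λ block → proj₂ block refl)) (cong (b ∷_) (swapTail-const b w w≡b))

  All≡⇒replicate : ∀ {m b} (w : Word m) → All (_≡ b) w → w ≡ replicate m b
  All≡⇒replicate [] [] = refl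
  All≡⇒replicate (c ∷ w) (refl ∷ w≡b) = cong (c ∷_) (All≡⇒replicate w w≡b)

  replicate-All≡ : ∀ m (b : Fin n) → All (_≡ b) (replicate m b)
  replicate-All≡ zero b = []
  replicate-All≡ (suc m) b = refl ∷ replicate-All≡ m b

  replicate-∷ʳ : ∀ m (a : Fin n) → replicate m a ∷ʳ a ≡ replicate (suc m) a
  replicate-∷ʳ zero a = refl
  replicate-∷ʳ (suc m) a = cong (a ∷_) (replicate-∷ʳ m a)

  swapTail-involutive : ∀ {m} (w : Word (suc m)) → swapTail (swapTail w) ≡ w
  swapTail-involutive (a ∷ []) = refl
  swapTail-involutive (a ∷ b ∷ w) with tailBlock? a b w
  ... | yes (w≡b , a≢b) =
    trans (swapTail-block b a (replicate _ a) (replicate-All≡ _ a , a≢b ∘ sym))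
          (cong (λ u → a ∷ b ∷ u) (sym (All≡⇒replicate w w≡b)))
  ... | no ¬block = lemma (swapTail (b ∷ w)) (swapTail-involutive (b ∷ w))
    where
    lemma : ∀ u → swapTail u ≡ b ∷ w → swapTail (a ∷ u) ≡ a ∷ b ∷ w
    lemma (c ∷ u) swap-u with tailBlock? a c u
    ... | no _ = cong (a ∷_) swap-u
    ... | yes (u≡c , a≢c) with trans (sym (swapTail-const c u u≡c)) swap-u
    ...   | refl = contradiction (u≡c , a≢c) ¬block

  All-∷ʳ⁻ : ∀ {m b} (w : Word m) {z} → All (_≡ b) (w ∷ʳ z) → All (_≡ b) w × z ≡ b
  All-∷ʳ⁻ [] (z≡b ∷ []) = [] , z≡b
  All-∷ʳ⁻ (c ∷ w) (c≡b ∷ rest) = let (w≡b , z≡b) = All-∷ʳ⁻ w rest in (c≡b ∷ w≡b) , z≡b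

  last-const : ∀ {m} b (w : Word m) → All (_≡ b) w → last (b ∷ w) ≡ b
  last-const b [] [] = refl
  last-const b (c ∷ w) (refl ∷ w≡b) = last-const b w w≡b

  extreme : ∀ {m} → Word (suc m) → Word (suc (suc m))
  extreme w = w ∷ʳ last w

  data NeighbourOf {k} (w : Word (suc k)) (z : Fin n) (v : Word (suc (suc k))) : Set where
    same-copy : ∀ {z'} → v ≡ w ∷ʳ z' → Adj z z' → NeighbourOf w z v
    -- an edge p a z ~ p z a towards a copy with last letter z adjacent to last w = a
    adjacent-copy : Adj z (last w) → NeighbourOf w z v
    mate : z ≡ last w → v ≡ extreme (swapTail w) → Adj (last w) (last (swapTail w)) → NeighbourOf w z v

  neighbour-cases : ∀ {k} (w : Word (suc k)) z {v} → (w ∷ʳ z) ~ v → NeighbourOf w z v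
  neighbour-cases (a ∷ []) z (deeper (top adj [] [])) = same-copy refl adj
  neighbour-cases (a ∷ []) z (top adj (refl ∷ []) _) = adjacent-copy (Adj-sym a z adj)
  neighbour-cases {suc k} (a ∷ b ∷ w) z (top adj (refl ∷ wz≡b) v≡a)
    with All-∷ʳ⁻ w wz≡b
  ... | w≡b , refl = mate (sym (last-const b w w≡b)) v≡mate
                          (subst₂ Adj (sym (last-const b w w≡b)) (sym last-mate) (Adj-sym a b adj))
    where
    swap≡ : swapTail (a ∷ b ∷ w) ≡ b ∷ replicate (suc k) a
    swap≡ = swapTail-block a b w (w≡b , Adj⇒≢ adj)
    last-mate : last (swapTail (a ∷ b ∷ w)) ≡ a
    last-mate = trans (cong last swap≡) (last-const a (replicate k a) (replicate-All≡ k a))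
    v≡mate : _ ≡ extreme (swapTail (a ∷ b ∷ w))
    v≡mate = trans (cong (b ∷_) (trans (All≡⇒replicate _ v≡a) (sym (replicate-∷ʳ _ a))))
                   (sym (cong₂ _∷ʳ_ swap≡ last-mate))
  neighbour-cases (a ∷ b ∷ w) z (deeper r) with neighbour-cases (b ∷ w) z r
  ... | same-copy refl adj = same-copy refl adj
  ... | adjacent-copy adj = adjacent-copy adj
  ... | mate z≡ v≡ adj with tailBlock? a b w
  ...   | yes (w≡b , _) = contradiction (subst (Adj _) (cong last (swapTail-const b w w≡b)) adj) (Adj-irrefl _)
  ...   | no ¬block =
    mate z≡ (trans (cong (a ∷_) v≡) (cong extreme (sym swap≡))) (subst (Adj _) (cong last (sym swap≡)) adj)
    where
    swap≡ : swapTail (a ∷ b ∷ w) ≡ a ∷ swapTail (b ∷ w)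
    swap≡ = swapTail-∷ a b w ¬block

  module UpperBound (D₁ : List (Fin n)) (D₁-unique : Unique D₁) (D₁-dom : Dominating Adj D₁)
    (X : List (Fin n)) (X-unique : Unique X) (X⊆D₁ : _⊆ₗ_ Adj X D₁) (X-no-isolated : NoIsolated Adj X)
    (k : ℕ) where

    Excluded : Word (suc k) → Fin n → Set
    Excluded w z = z ≡ last w × z ∈ X

    excluded? : ∀ w z → Dec (Excluded w z)
    excluded? w z = (z ≟ᶠ last w) ×-dec (z ∈ᶠ? X)

    Kept : Word (suc k) → Fin n → Set
    Kept w z = z ∈ D₁ × ¬ Excluded w z

    kept? : ∀ w z → Dec (Kept w z)
    kept? w z = (z ∈ᶠ? D₁) ×-dec ¬? (excluded? w z)

    S : List (Word (suc (suc k)))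
    S = filter (λ u → kept? (init u) (last u)) (words n (suc (suc k)))

    S-unique : Unique S
    S-unique = filter⁺ (λ u → kept? (init u) (last u)) (words-unique n (suc (suc k)))

    S⁺ : ∀ {p : Word k} {x z} → z ∈ D₁ → ¬ (z ≡ x × z ∈ X) → (p ∷ʳ x ∷ʳ z) ∈ S
    S⁺ {p} {x} {z} z∈D₁ ¬excluded =
      ∈-filter⁺ (λ u → kept? (init u) (last u)) (words-complete n _ (p ∷ʳ x ∷ʳ z))
      (subst₂ Kept (sym (init-∷ʳ z (p ∷ʳ x))) (sym (last-∷ʳ z (p ∷ʳ x)))
        (z∈D₁ , λ (z≡ , z∈X) → ¬excluded (trans z≡ (last-∷ʳ x p) , z∈X)))

    -- S dominates p·x·z: if z ∈ D₁ and z = x ∈ X, use a neighbour of z in X (same copy);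
    -- if z ∉ D₁, use a D₁-neighbour y of z, in copy p·x, or in copy p·z when y = x ∈ X.
    S-dominates : ∀ (p : Word k) x z → (p ∷ʳ x ∷ʳ z) ∈ S ⊎ ∃ λ v → v ∈ S × (p ∷ʳ x ∷ʳ z) ~ v
    S-dominates p x z with z ∈ᶠ? D₁
    ... | yes z∈D₁ with (z ≟ᶠ x) ×-dec (z ∈ᶠ? X)
    ...   | no ¬excluded = inj₁ (S⁺ z∈D₁ ¬excluded)
    ...   | yes (refl , z∈X) with X-no-isolated z z∈X
    ...     | y , y∈X , adj = inj₂ (_ , S⁺ (X⊆D₁ y y∈X) (λ (y≡z , _) → Adj⇒≢ adj (sym y≡z)) ,
                                   same-copy-edge (p ∷ʳ z) adj)
    S-dominates p x z | no z∉D₁ with D₁-dom z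
    ... | inj₁ z∈D₁ = contradiction z∈D₁ z∉D₁
    ... | inj₂ (y , y∈D₁ , adj) with (y ≟ᶠ x) ×-dec (y ∈ᶠ? X)
    ...   | no ¬excluded = inj₂ (_ , S⁺ y∈D₁ ¬excluded , same-copy-edge (p ∷ʳ x) adj)
    ...   | yes (refl , _) = inj₂ (_ , S⁺ y∈D₁ (λ (y≡z , _) → z∉D₁ (subst (_∈ D₁) y≡z y∈D₁)) ,
                                   adjacent-copy-edge p (Adj-sym z y adj))

    S-dom : Dominating _~_ S
    S-dom u = subst (λ u → u ∈ S ⊎ ∃ λ v → v ∈ S × u ~ v)
      (trans (cong (_∷ʳ last u) (init-∷ʳ-last (init u))) (init-∷ʳ-last u))
      (S-dominates (init (init u)) (last (init u)) (last u))

    copy-count : ∀ w → ∑ᶠ (λ z → ind (kept? w z)) + ind (last w ∈ᶠ? X) ≡ length D₁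
    copy-count w = begin
      ∑ᶠ (λ z → ind (kept? w z)) + ind (last w ∈ᶠ? X)
        ≡⟨ cong (∑ᶠ (λ z → ind (kept? w z)) +_) excluded-count ⟨
      ∑ᶠ (λ z → ind (kept? w z)) + ∑ᶠ (λ z → ind (excluded? w z))
        ≡⟨ Letters.∑-+ (λ z → ind (kept? w z)) (λ z → ind (excluded? w z)) ⟨
      ∑ᶠ (λ z → ind (kept? w z) + ind (excluded? w z))
        ≡⟨ Letters.∑-cong (λ z → ind-split (z ∈ᶠ? D₁) (excluded? w z) (λ (_ , z∈X) → X⊆D₁ z z∈X)) ⟩
      ∑ᶠ (λ z → ind (z ∈ᶠ? D₁))
        ≡⟨ Letters.∑-count D₁-unique ⟩
      length D₁ ∎
      where
      open ≡-Reasoning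
      excluded-count : ∑ᶠ (λ z → ind (excluded? w z)) ≡ ind (last w ∈ᶠ? X)
      excluded-count = trans (Letters.∑-point (excluded? w) (last w) (λ z → proj₁))
        (ind-⇔ (excluded? w (last w)) (last w ∈ᶠ? X) proj₂ (refl ,_))

    S-by-copies : length S ≡ ∑ʷ (suc k) (λ w → ∑ᶠ (λ z → ind (kept? w z)))
    S-by-copies = begin
      length S
        ≡⟨ sum-map-ind (λ u → kept? (init u) (last u)) (words n (suc (suc k))) ⟨
      ∑ʷ (suc (suc k)) (λ u → ind (kept? (init u) (last u)))
        ≡⟨ ∑ʷ-∷ʳ (suc k) (λ u → ind (kept? (init u) (last u))) ⟩
      ∑ʷ (suc k) (λ w → ∑ᶠ (λ z → ind (kept? (init (w ∷ʳ z)) (last (w ∷ʳ z)))))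
        ≡⟨ Words.∑-cong (suc k) (λ w → Letters.∑-cong (λ z →
             cong₂ (λ w' z' → ind (kept? w' z')) (init-∷ʳ z w) (last-∷ʳ z w))) ⟩
      ∑ʷ (suc k) (λ w → ∑ᶠ (λ z → ind (kept? w z))) ∎
      where open ≡-Reasoning

    S-size : length S + n ^ k * length X ≡ n ^ suc k * length D₁
    S-size = begin
      length S + n ^ k * length X
        ≡⟨ cong₂ _+_ S-by-copies (sym (∑ʷ-last-count k X-unique)) ⟩
      ∑ʷ (suc k) kept-count + ∑ʷ (suc k) (λ w → ind (last w ∈ᶠ? X))
        ≡⟨ Words.∑-+ (suc k) kept-count (λ w → ind (last w ∈ᶠ? X)) ⟨
      ∑ʷ (suc k) (λ w → kept-count w + ind (last w ∈ᶠ? X))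
        ≡⟨ Words.∑-cong (suc k) copy-count ⟩
      ∑ʷ (suc k) (λ _ → length D₁)
        ≡⟨ ∑ʷ-const (suc k) (length D₁) ⟩
      n ^ suc k * length D₁ ∎
      where
      open ≡-Reasoning
      kept-count : Word (suc k) → ℕ
      kept-count w = ∑ᶠ (λ z → ind (kept? w z))

  module LowerBound (Adj? : ∀ a b → Dec (Adj a b))
    (D : List (Fin n)) (D-γ : IsGammaSet Adj D) (D-only : ∀ L → IsGammaSet Adj L → _⊆ₗ_ Adj L D)
    (k : ℕ) (S : List (Word (suc (suc k)))) (S-unique : Unique S) (S-dom : Dominating _~_ S) where

    D-min : ∀ L → Unique L → Dominating Adj L → length D ≤ length L
    D-min = proj₂ (proj₂ D-γ)

    γ-sized⊆D : ∀ L → Unique L → Dominating Adj L → length L ≡ length D → ∀ x → x ∈ L → x ∈ D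
    γ-sized⊆D L uL domL |L|≡γ = D-only L (uL , domL , λ L' uL' domL' →
      subst (_≤ length L') (sym |L|≡γ) (D-min L' uL' domL'))

    D° : List (Fin n)
    D° = filter (λ x → any? (Adj? x) D) D

    D°⁺ : ∀ {x y} → x ∈ D → y ∈ D → Adj x y → x ∈ D°
    D°⁺ x∈D y∈D adj = ∈-filter⁺ (λ x → any? (Adj? x) D) x∈D (lose y∈D adj)

    trace : Word (suc k) → List (Fin n)
    trace w = filter (λ z → (w ∷ʳ z) ∈ʷ? S) (allFin n)

    trace⁺ : ∀ {w z} → (w ∷ʳ z) ∈ S → z ∈ trace w
    trace⁺ {w} {z} = ∈-filter⁺ (λ z → (w ∷ʳ z) ∈ʷ? S) (∈-allFin z)

    trace⁻ : ∀ {w z} → z ∈ trace w → (w ∷ʳ z) ∈ S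
    trace⁻ {w} = proj₂ ∘ ∈-filter⁻ (λ z → (w ∷ʳ z) ∈ʷ? S) {xs = allFin n}

    trace-unique : ∀ w → Unique (trace w)
    trace-unique w = filter⁺ (λ z → (w ∷ʳ z) ∈ʷ? S) (allFin⁺ n)

    -- Every vertex w·z is dominated by S, and by `neighbour-cases` the dominator lies in
    -- copy w or is reached through the letter last w: the trace plus last w dominates G.
    trace-dominating : ∀ w → Dominating Adj (last w ∷ trace w)
    trace-dominating w z with S-dom (w ∷ʳ z)
    ... | inj₁ wz∈S = inj₁ (there (trace⁺ wz∈S))
    ... | inj₂ (v , v∈S , wz~v) with neighbour-cases w z wz~v
    ...   | same-copy refl adj = inj₂ (_ , there (trace⁺ v∈S) , adj)
    ...   | adjacent-copy adj = inj₂ (last w , here refl , adj)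
    ...   | mate z≡ _ _ = inj₁ (here z≡)

    Wasteful : Word (suc k) → Set
    Wasteful w = extreme w ∈ S × last w ∉ D

    wasteful? : ∀ w → Dec (Wasteful w)
    wasteful? w = extreme w ∈ʷ? S ×-dec ¬? (last w ∈ᶠ? D)

    waste : Word (suc k) → ℕ
    waste w = ind (wasteful? w)

    credit : Word (suc k) → ℕ
    credit w = ind (last w ∈ᶠ? D°) + waste (swapTail w)

    -- Copy w with extreme vertex in S: the trace alone dominates G, and it exceeds γ(G)
    -- when the copy is wasteful, since a γ(G)-sized trace would be D itself.
    bound-extreme∈S : ∀ w → extreme w ∈ S → length D + waste w ≤ length (trace w) + credit w
    bound-extreme∈S w ext∈S = by-letter (last w ∈ᶠ? D)
      where
      x∈trace : last w ∈ trace w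
      x∈trace = trace⁺ ext∈S
      trace-dom : Dominating Adj (trace w)
      trace-dom = dominating-⊆ (λ { (here refl) → x∈trace ; (there z∈trace) → z∈trace }) (trace-dominating w)
      γ≤trace : length D ≤ length (trace w)
      γ≤trace = D-min (trace w) (trace-unique w) trace-dom
      by-letter : Dec (last w ∈ D) → length D + waste w ≤ length (trace w) + credit w
      by-letter (yes x∈D) = begin
        length D + waste w          ≡⟨ cong (length D +_) (ind-no (wasteful? w) (λ (_ , x∉D) → x∉D x∈D)) ⟩
        length D + 0                ≤⟨ +-mono-≤ γ≤trace z≤n ⟩
        length (trace w) + credit w ∎
        where open ≤-Reasoning
      by-letter (no x∉D) = begin
        length D + waste w          ≡⟨ cong (length D +_) (ind-yes (wasteful? w) (ext∈S , x∉D)) ⟩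
        length D + 1                ≡⟨ +-comm (length D) 1 ⟩
        suc (length D)              ≤⟨ ≤∧≢⇒< γ≤trace γ≢trace ⟩
        length (trace w)            ≤⟨ m≤m+n (length (trace w)) (credit w) ⟩
        length (trace w) + credit w ∎
        where
        open ≤-Reasoning
        γ≢trace : length D ≢ length (trace w)
        γ≢trace γ≡ = x∉D (γ-sized⊆D (trace w) (trace-unique w) trace-dom (sym γ≡) _ x∈trace)

    -- Copy w with extreme vertex outside S: the trace together with last w dominates G.
    -- If this is tight, last w ∈ D; then either last w ∈ D°, or the extreme vertex is
    -- dominated only through its mate, and the mate copy swapTail w is wasteful.
    bound-extreme∉S : ∀ w → extreme w ∉ S → length D + waste w ≤ length (trace w) + credit w
    bound-extreme∉S w ext∉S = by-size (m≤n⇒m<n∨m≡n γ≤1+trace)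
      where
      x∉trace : last w ∉ trace w
      x∉trace = ext∉S ∘ trace⁻
      x∷trace-unique : Unique (last w ∷ trace w)
      x∷trace-unique = ¬Any⇒All¬ (trace w) x∉trace ∷ trace-unique w
      γ≤1+trace : length D ≤ suc (length (trace w))
      γ≤1+trace = D-min (last w ∷ trace w) x∷trace-unique (trace-dominating w)
      unwasted : waste w ≡ 0
      unwasted = ind-no (wasteful? w) (ext∉S ∘ proj₁)

      by-size : length D < suc (length (trace w)) ⊎ length D ≡ suc (length (trace w))
              → length D + waste w ≤ length (trace w) + credit w
      by-size (inj₁ (s≤s γ≤trace)) = begin
        length D + waste w          ≡⟨ cong (length D +_) unwasted ⟩
        length D + 0                ≡⟨ +-identityʳ (length D) ⟩
        length D                    ≤⟨ γ≤trace ⟩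
        length (trace w)            ≤⟨ m≤m+n (length (trace w)) (credit w) ⟩
        length (trace w) + credit w ∎
        where open ≤-Reasoning
      by-size (inj₂ γ≡1+trace) = begin
        length D + waste w          ≡⟨ cong (length D +_) unwasted ⟩
        length D + 0                ≡⟨ trans (+-identityʳ (length D)) γ≡1+trace ⟩
        suc (length (trace w))      ≡⟨ +-comm 1 (length (trace w)) ⟩
        length (trace w) + 1        ≤⟨ +-monoʳ-≤ (length (trace w)) (credit-positive (last w ∈ᶠ? D°)) ⟩
        length (trace w) + credit w ∎
        where
        open ≤-Reasoning
        x∷trace⊆D : ∀ {z} → z ∈ last w ∷ trace w → z ∈ D
        x∷trace⊆D = γ-sized⊆D (last w ∷ trace w) x∷trace-unique (trace-dominating w) (sym γ≡1+trace) _
        credit-positive : (d : Dec (last w ∈ D°)) → 1 ≤ ind d + waste (swapTail w)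
        credit-positive (yes _) = s≤s z≤n
        credit-positive (no x∉D°) with S-dom (extreme w)
        ... | inj₁ ext∈S = contradiction ext∈S ext∉S
        ... | inj₂ (v , v∈S , ext~v) with neighbour-cases w (last w) ext~v
        ...   | same-copy refl adj =
                contradiction (D°⁺ (x∷trace⊆D (here refl)) (x∷trace⊆D (there (trace⁺ v∈S))) adj) x∉D°
        ...   | adjacent-copy adj = contradiction adj (Adj-irrefl (last w))
        ...   | mate _ v≡ adj = ≤-reflexive (sym (ind-yes (wasteful? (swapTail w))
                  (subst (_∈ S) v≡ v∈S , λ y∈D → x∉D° (D°⁺ (x∷trace⊆D (here refl)) y∈D adj))))

    block-bound : ∀ w → length D + waste w ≤ length (trace w) + credit w
    block-bound w = by-membership (extreme w ∈ʷ? S)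
      where
      by-membership : Dec (extreme w ∈ S) → length D + waste w ≤ length (trace w) + credit w
      by-membership (yes ext∈S) = bound-extreme∈S w ext∈S
      by-membership (no ext∉S) = bound-extreme∉S w ext∉S

    ∑-trace : ∑ʷ (suc k) (λ w → length (trace w)) ≡ length S
    ∑-trace = begin
      ∑ʷ (suc k) (λ w → length (trace w))
        ≡⟨ Words.∑-cong (suc k) (λ w → sym (sum-map-ind (λ z → (w ∷ʳ z) ∈ʷ? S) (allFin n))) ⟩
      ∑ʷ (suc k) (λ w → ∑ᶠ (λ z → ind ((w ∷ʳ z) ∈ʷ? S)))
        ≡⟨ ∑ʷ-∷ʳ (suc k) (λ u → ind (u ∈ʷ? S)) ⟨
      ∑ʷ (suc (suc k)) (λ u → ind (u ∈ʷ? S))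
        ≡⟨ Words.∑-count (suc (suc k)) S-unique ⟩
      length S ∎
      where open ≡-Reasoning

    -- The wasted copies are counted on both sides, once directly and once through
    -- their mates, because swapTail is an involution.
    ∑-credit : ∑ʷ (suc k) credit ≡ n ^ k * length D° + ∑ʷ (suc k) waste
    ∑-credit = trans (Words.∑-+ (suc k) (λ w → ind (last w ∈ᶠ? D°)) (waste ∘ swapTail))
      (cong₂ _+_ (∑ʷ-last-count k (filter⁺ (λ x → any? (Adj? x) D) (proj₁ D-γ)))
                 (Words.∑-involution (suc k) swapTail swapTail-involutive waste))

    lower-bound : n ^ suc k * length D ≤ length S + n ^ k * length D°
    lower-bound = +-cancelʳ-≤ (∑ʷ (suc k) waste) _ _ (begin
      n ^ suc k * length D + ∑ʷ (suc k) waste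
        ≡⟨ cong (_+ ∑ʷ (suc k) waste) (∑ʷ-const (suc k) (length D)) ⟨
      ∑ʷ (suc k) (λ _ → length D) + ∑ʷ (suc k) waste
        ≡⟨ Words.∑-+ (suc k) (λ _ → length D) waste ⟨
      ∑ʷ (suc k) (λ w → length D + waste w)
        ≤⟨ Words.∑-mono (suc k) block-bound ⟩
      ∑ʷ (suc k) (λ w → length (trace w) + credit w)
        ≡⟨ Words.∑-+ (suc k) (λ w → length (trace w)) credit ⟩
      ∑ʷ (suc k) (λ w → length (trace w)) + ∑ʷ (suc k) credit
        ≡⟨ cong₂ _+_ ∑-trace ∑-credit ⟩
      length S + (n ^ k * length D° + ∑ʷ (suc k) waste)
        ≡⟨ +-assoc (length S) _ _ ⟨
      length S + n ^ k * length D° + ∑ʷ (suc k) waste ∎)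
      where open ≤-Reasoning

    D°-candidate : XiCandidate Adj D°
    D°-candidate = D , D-γ , filter⁺ (λ x → any? (Adj? x) D) (proj₁ D-γ) ,
      (λ x x∈D° → proj₁ (∈-filter⁻ (λ x → any? (Adj? x) D) {xs = D} x∈D°)) , D°-no-isolated
      where
      D°-no-isolated : NoIsolated Adj D°
      D°-no-isolated x x∈D° with ∈-filter⁻ (λ x → any? (Adj? x) D) {xs = D} x∈D°
      ... | x∈D , has-neighbour with find has-neighbour
      ...   | y , y∈D , adj = y , D°⁺ y∈D x∈D (Adj-sym x y adj) , adj

  -- The lower bound in terms of ξ(G).  Adjacency is decidable only classically, which suffices
  -- because the conclusion is a decidable inequality.
  lower-bound-ξ : ∀ {D} → IsGammaSet Adj D → (∀ L → IsGammaSet Adj L → _⊆ₗ_ Adj L D)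
    → ∀ {x} → (∀ L → XiCandidate Adj L → length L ≤ x)
    → ∀ k S → Unique S → Dominating (SAdj Adj (suc (suc k))) S
    → n ^ suc k * length D ≤ length S + n ^ k * x
  lower-bound-ξ {D} D-γ D-only {x} ξ-max k S S-unique S-dom =
    decidable-stable (_ ≤? _) (¬¬-map bound (¬¬-∀-Fin λ a → ¬¬-∀-Fin λ b → ¬¬-excluded-middle))
    where
    bound : (∀ a b → Dec (Adj a b)) → n ^ suc k * length D ≤ length S + n ^ k * x
    bound Adj? = ≤-trans lower-bound (+-monoʳ-≤ (length S) (*-monoʳ-≤ (n ^ k) (ξ-max D° D°-candidate)))
      where open LowerBound Adj? D D-γ D-only k S S-unique (dominating-map (λ {u} {v} → SAdj⇒~ u v) S-dom)

solve-size : ∀ n k g x s → s + n ^ k * x ≡ n ^ suc k * g → s ≡ n ^ k * (n * g ∸ x)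
solve-size n k g x s eq = begin
  s                               ≡⟨ m+n∸n≡m s (n ^ k * x) ⟨
  s + n ^ k * x ∸ n ^ k * x        ≡⟨ cong (_∸ n ^ k * x) eq ⟩
  n * n ^ k * g ∸ n ^ k * x        ≡⟨ cong (λ c → c * g ∸ n ^ k * x) (*-comm n (n ^ k)) ⟩
  n ^ k * n * g ∸ n ^ k * x        ≡⟨ cong (_∸ n ^ k * x) (*-assoc (n ^ k) n g) ⟩
  n ^ k * (n * g) ∸ n ^ k * x      ≡⟨ *-distribˡ-∸ (n ^ k) (n * g) x ⟨
  n ^ k * (n * g ∸ x)             ∎
  where open ≡-Reasoning

theorem13 : (n : ℕ) (Adj : Fin n → Fin n → Set)
    → (∀ u v → Adj u v → Adj v u)
    → (∀ u → ¬ Adj u u)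
    → UniqueGammaSet Adj
    → (g : ℕ) → IsDominationNumber Adj g → IsVertexCoverNumber Adj g
    → (x : ℕ) → IsXi Adj x
    → (t : ℕ) → 2 ≤ t
    → IsDominationNumber (SAdj Adj t) (n ^ (t ∸ 2) * (n * g ∸ x))
theorem13 n Adj Adj-sym Adj-irrefl (D , D-γ , D-only) g (D₀ , D₀-γ , |D₀|≡g) _
          x ((X , (D₁ , D₁-γ , X-unique , X⊆D₁ , X-no-isolated) , |X|≡x) , ξ-max)
          (suc (suc k)) (s≤s (s≤s z≤n)) =
  S , (S-unique , dominating-map ~⇒SAdj S-dom , S-minimum) , solve-size n k g x (length S) S-size-γξ
  where
  open Sierpinski n Adj Adj-sym Adj-irrefl
  open UpperBound D₁ (proj₁ D₁-γ) (proj₁ (proj₂ D₁-γ)) X X-unique X⊆D₁ X-no-isolated k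

  γ-size : ∀ {L} → IsGammaSet Adj L → length L ≡ g
  γ-size L-γ = trans (γ-sets-same-size L-γ D₀-γ) |D₀|≡g

  S-size-γξ : length S + n ^ k * x ≡ n ^ suc k * g
  S-size-γξ = subst₂ (λ x' g' → length S + n ^ k * x' ≡ n ^ suc k * g') |X|≡x (γ-size D₁-γ) S-size

  S-minimum : ∀ S' → Unique S' → Dominating (SAdj Adj (suc (suc k))) S' → length S ≤ length S'
  S-minimum S' S'-unique S'-dom = +-cancelʳ-≤ (n ^ k * x) _ _ (begin
    length S + n ^ k * x   ≡⟨ S-size-γξ ⟩
    n ^ suc k * g          ≡⟨ cong (n ^ suc k *_) (γ-size D-γ) ⟨
    n ^ suc k * length D   ≤⟨ lower-bound-ξ D-γ (proj₁ ∘₂ D-only) ξ-max k S' S'-unique S'-dom ⟩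
    length S' + n ^ k * x  ∎)
    where open ≤-Reasoning
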